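{- Let $\Delta=\Delta_{m,\mathbf a}^{(\mathbf r)}=\sum_{i=1}^n a_iP_m^{(r_i)}(x_i)$ be a generalized primitive shifted $m$-gonal form, and let $p$ be a prime for which $\lambda_p$ is defined (an odd prime with $p\nmid m-2$, or $p=2$ when $m\equiv 0\pmod 4$). (1) For every prime $q\ne p$, $\Delta$ is $\mathbb Z_q$-universal if and only if $\lambda_p(\Delta)$ is $\mathbb Z_q$-universal. (2) Let $p$ be odd. If $\Delta$ is not $\mathbb Z_2$-universal and its coefficient lattice $\langle a_1,\dots,a_n\rangle\otimes\mathbb Z_2$ represents $\langle u,u'\rangle\otimes\mathbb Z_2$ for some $u\equiv1\pmod4$, $u'\equiv 3\pmod 4$ (resp. represents no such binary lattice), then $\lambda_p(\Delta)$ is also not $\mathbb Z_2$-universal and its coefficient lattice over $\mathbb Z_2$ likewise represents such a binary lattice (resp. represents no such binary lattice).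
   Context: For an integer $m\ge 3$ and an integer $r$ with $0\le r\le m-2$, $\gcd(r,m-2)=1$, let $P_m^{(r)}(x)=\frac{m-2}{2}x^2-\frac{m-2-2r}{2}x$ for $x\in\mathbb Z$. A generalized shifted $m$-gonal form is $\Delta(\mathbf x)=\sum_{i=1}^n a_iP_m^{(r_i)}(x_i)$ with positive integers $a_i$ and such levels $r_i$; primitive means $\gcd(a_1,\dots,a_n)=1$. It is $\mathbb Z_q$-universal if $\Delta(\mathbf x)=N$ is solvable in $\mathbb Z_q^n$ for every $N\in\mathbb Z_q$. The coefficient lattice of a form with coefficients $b_1,\dots,b_n$ is the diagonal quadratic $\mathbb Z_2$-lattice $\langle b_1,\dots,b_n\rangle\otimes\mathbb Z_2$; "represents $\langle u,u'\rangle\otimes\mathbb Z_2$" means it contains a sublattice isometric to it. $\lambda_p$-transformation: for each $i$ with $p\nmid a_i$, put $c_i=\frac{m-2-2r_i}{2(m-2)}\in\mathbb Z_p$, let $j_i$ be the unique integer with $-\frac p2+c_i\le j_i\le\frac p2+c_i$ and $j_i\equiv c_i\pmod p$, and $r_i'=\frac{(m-2)(p+2j_i)-(m-2-2r_i)}{2p}$. Then $\lambda_p(\Delta)(\mathbf x)=p^{ -k}\big(\sum_{p\nmid a_i}p^2a_iP_m^{(r_i')}(x_i)+\sum_{p\mid a_i}a_iP_m^{(r_i)}(x_i)\big)$ with $k=\min\{2,\mathrm{ord}_p(a_i):p\mid a_i\}$. -}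

module Defs where

open import Data.Nat as ℕ using (ℕ; zero; suc)
import Data.Nat.GCD as ℕG
import Data.Nat.Divisibility as ℕD
open import Data.Integer as ℤ using (ℤ; +_; _-_; -_)
open import Data.Integer.DivMod using (_/ℕ_)
open import Data.Integer.Divisibility using (_∣_)
open import Data.Fin using (Fin)
import Data.Fin as F
open import Data.Product using (Σ; ∃; ∃-syntax; _×_; _,_)
open import Data.Sum using (_⊎_)
open import Relation.Nullary using (¬_)
open import Relation.Binary.PropositionalEquality using (_≡_)

sumℤ : ∀ {n} → (Fin n → ℤ) → ℤ
sumℤ {zero}  f = + 0
sumℤ {suc n} f = f F.zero ℤ.+ sumℤ (λ i → f (F.suc i))

gcdAll : ∀ {n} → (Fin n → ℕ) → ℕ
gcdAll {zero}  a = 0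
gcdAll {suc n} a = ℕG.gcd (a F.zero) (gcdAll (λ i → a (F.suc i)))

-- The q-adic integers ℤ_q as the inverse limit of ℤ/q^kℤ :
-- a compatible sequence (x_k), x_k a representative mod q^k,
-- with x_{k+1} ≡ x_k (mod q^k).

record ℤ[_] (q : ℕ) : Set where
  field
    seq    : ℕ → ℤ
    compat : ∀ k → (+ (q ℕ.^ k)) ∣ (seq (suc k) - seq k)
open ℤ[_] public

_≈[_]_ : ∀ {q} → ℤ[ q ] → (q' : ℕ) → ℤ[ q ] → Set
_≈[_]_ {q} x _ y = ∀ k → (+ (q ℕ.^ k)) ∣ (seq x k - seq y k)

-- Shifted m-gonal numbers  P_m^{(r)}(x) = ((m-2)x^2 - (m-2-2r)x)/2
-- (an exact division: the numerator is always even)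

P : ℕ → ℤ → ℤ → ℤ
P m r x = ((+ (m ℕ.∸ 2)) ℤ.* x ℤ.* x - ((+ (m ℕ.∸ 2)) - + 2 ℤ.* r) ℤ.* x) /ℕ 2

formVal : ℕ → ∀ {n} → (Fin n → ℤ) → (Fin n → ℤ) → (Fin n → ℤ) → ℤ
formVal m a r x = sumℤ (λ i → a i ℤ.* P m (r i) (x i))

-- Z_q-universality: for every N ∈ ℤ_q there is x ∈ ℤ_q^n with Δ(x) = N.
-- Δ(x) mod q^k is computed from representatives of the x_i mod q^{k+1}
-- (P_m^{(r)} mod q^k only depends on x mod q^{k+1}, also for q = 2).
ZUniversal : (q m : ℕ) → ∀ {n} → (Fin n → ℤ) → (Fin n → ℤ) → Set
ZUniversal q m {n} a r =
  (N : ℤ[ q ]) → Σ (Fin n → ℤ[ q ]) λ x → ((k : ℕ) →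
     (+ (q ℕ.^ k)) ∣ (formVal m a r (λ i → seq (x i) (suc k)) - seq N k))

IsPrimShiftedForm : (m : ℕ) → ∀ {n} → (Fin n → ℕ) → (Fin n → ℕ) → Set
IsPrimShiftedForm m a r =
  (3 ℕ.≤ m)
  × (∀ i → 1 ℕ.≤ a i)
  × (∀ i → r i ℕ.≤ m ℕ.∸ 2)
  × (∀ i → ℕG.gcd (r i) (m ℕ.∸ 2) ≡ 1)
  × (gcdAll a ≡ 1)

LambdaAdmissible : ℕ → ℕ → Set
LambdaAdmissible m p =
  ((¬ (2 ℕD.∣ p)) × ¬ (p ℕD.∣ (m ℕ.∸ 2))) ⊎ ((p ≡ 2) × (4 ℕD.∣ m))

-- Coefficient lattice ⟨b_1,…,b_n⟩ ⊗ ℤ_2 : ℤ_2^n with Q(x) = Σ b_i x_i^2,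
-- bilinear form B(x,y) = Σ b_i x_i y_i.
-- It represents ⟨u,u'⟩ ⊗ ℤ_2 iff there is an injective ℤ_2-linear isometry
-- ⟨u,u'⟩ → ⟨b⟩, i.e. images v, w of the orthogonal basis e_1, e_2 with
-- Q(v) = u, Q(w) = u', B(v,w) = 0, and α v + β w = 0 ⇒ α = β = 0.

Represents₂ : ∀ {n} → (Fin n → ℤ) → ℤ[ 2 ] → ℤ[ 2 ] → Set
Represents₂ {n} b u u' =
  Σ (Fin n → ℤ[ 2 ]) λ v → Σ (Fin n → ℤ[ 2 ]) λ w →
    (∀ k → (+ (2 ℕ.^ k)) ∣ (sumℤ (λ i → b i ℤ.* seq (v i) k ℤ.* seq (v i) k) - seq u k))
  × (∀ k → (+ (2 ℕ.^ k)) ∣ (sumℤ (λ i → b i ℤ.* seq (w i) k ℤ.* seq (w i) k) - seq u' k))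
  × (∀ k → (+ (2 ℕ.^ k)) ∣ sumℤ (λ i → b i ℤ.* seq (v i) k ℤ.* seq (w i) k))
  × ((α β : ℤ[ 2 ]) →
       (∀ i k → (+ (2 ℕ.^ k)) ∣ (seq α k ℤ.* seq (v i) k ℤ.+ seq β k ℤ.* seq (w i) k)) →
       (∀ k → (+ (2 ℕ.^ k)) ∣ seq α k) × (∀ k → (+ (2 ℕ.^ k)) ∣ seq β k))

RepsMixedBinary : ∀ {n} → (Fin n → ℤ) → Set
RepsMixedBinary b =
  Σ ℤ[ 2 ] λ u → Σ ℤ[ 2 ] λ u' →
    ((+ 4) ∣ (seq u 2 - + 1)) × ((+ 4) ∣ (seq u' 2 - + 3)) × Represents₂ b u u'

-- With c = M/D, M = m-2-2r, D = 2(m-2):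
--  * -p/2 + c ≤ j ≤ p/2 + c   is written (multiplying by 2D > 0) as
--    -pD + 2M ≤ 2Dj ≤ pD + 2M ;
--  * j ≡ c (mod p) in ℤ_p means j - c ∈ pℤ_(p), i.e. t(Dj - M) = p s D
--    for some integers s, t with p ∤ t.

JCond : (m p r : ℕ) → ℤ → Set
JCond m p r j =
  let D = + (2 ℕ.* (m ℕ.∸ 2))
      M = (+ (m ℕ.∸ 2)) - + 2 ℤ.* + r
  in (- (+ p ℤ.* D) ℤ.+ + 2 ℤ.* M ℤ.≤ + 2 ℤ.* D ℤ.* j)
   × (+ 2 ℤ.* D ℤ.* j ℤ.≤ + p ℤ.* D ℤ.+ + 2 ℤ.* M)
   × (Σ ℤ λ s → Σ ℤ λ t → (¬ (+ p ∣ t)) × (t ℤ.* (D ℤ.* j - M) ≡ + p ℤ.* s ℤ.* D))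

-- IsLambda m p a r b r' : the form Σ b_i P_m^{(r'_i)}(x_i) is λ_p(Σ a_i P_m^{(r_i)}(x_i)).
-- k = min{2, ord_p(a_i) : p ∣ a_i}; the new coefficients are p^{-k}·p²a_i resp.
-- p^{-k}·a_i and the new levels r'_i = ((m-2)(p+2j_i) - (m-2-2r_i))/(2p).
IsLambda : (m p : ℕ) → ∀ {n} → (a r : Fin n → ℕ) → (b : Fin n → ℕ) → (r' : Fin n → ℤ) → Set
IsLambda m p {n} a r b r' =
  Σ ℕ λ k →
    ( (k ℕ.≤ 2)
    × (∀ i → p ℕD.∣ a i → (p ℕ.^ k) ℕD.∣ a i)
    × ((k ≡ 2) ⊎ (Σ (Fin n) λ i → (p ℕD.∣ a i) × ((p ℕ.^ k) ℕD.∣ a i) × ¬ ((p ℕ.^ suc k) ℕD.∣ a i))) )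
  × (∀ i →
       ((p ℕD.∣ a i) → ((p ℕ.^ k) ℕ.* b i ≡ a i) × (r' i ≡ + r i))
     × ((¬ (p ℕD.∣ a i)) → ((p ℕ.^ k) ℕ.* b i ≡ p ℕ.* p ℕ.* a i)
          × Σ ℤ λ j → JCond m p (r i) j
              × (+ (2 ℕ.* p) ℤ.* r' i
                   ≡ (+ (m ℕ.∸ 2)) ℤ.* (+ p ℤ.+ + 2 ℤ.* j) - ((+ (m ℕ.∸ 2)) - + 2 ℤ.* + r i))))

-- For q ≠ p the prime p is a unit in ℤ_q, and λ_p acts coordinatewise by unit changes of
-- variables: if p ∤ a_i, the substitution x = p y + j_i turns a_i P^{(r_i)}(x) into
-- p² a_i P^{(r'_i)}(y) + a_i P^{(r_i)}(j_i), and if p ∣ a_i nothing changes.  Hence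
-- p^k λ_p(Δ)(y) = Δ(τ y + j) - C with units τ_i, and such a relation transfers ℤ_q-universality
-- in both directions (units are inverted in ℤ_q by Newton iteration).  For odd p the coefficients
-- satisfy a_i s_i² = p^k b_i and b_i t_i² = p^{2-k} a_i with s_i, t_i ∈ {1, p}; scaling by odd
-- squares is an isometry and scaling by an odd constant c sends ⟨u, u'⟩ with u ≡ 1, u' ≡ 3 (mod 4)
-- to ⟨cu, cu'⟩, whose entries are again 1 and 3 mod 4 in some order.  Non-universality over ℤ_2
-- is part (1) with q = 2.
module Submission where

open import Defs
open import Data.Nat using (ℕ)
open import Data.Nat.Primality using (Prime)
open import Data.Integer using (ℤ; +_)
open import Data.Fin using (Fin)
open import Data.Product using (_×_)
open import Function.Bundles using (_⇔_)
open import Relation.Nullary using (¬_)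
open import Relation.Binary.PropositionalEquality using (_≢_)
open import Data.Nat.Divisibility using (_∣_)
open import Data.Empty using (⊥-elim)
import Data.Fin as F
open import Data.Integer as ℤ using (_+_; _*_; _-_; -_)
open import Data.Integer.DivMod using (_/ℕ_; _%ℕ_; a≡a%ℕn+[a/ℕn]*n; n%ℕd<d)
import Data.Integer.Divisibility as ℤ∣
import Data.Integer.Divisibility.Signed as ℤS
import Data.Integer.Properties as ℤP
open import Data.Integer.Tactic.RingSolver using (solve-∀)
open import Data.Nat as ℕ using (zero; suc; NonZero)
import Data.Nat.Coprimality as Coprimality
import Data.Nat.DivMod as ℕ/
import Data.Nat.Divisibility as ℕ∣
open import Data.Nat.GCD using (module Bézout)
import Data.Nat.Properties as ℕP
open import Data.Nat.Primality using (prime⇒irreducible; prime⇒nonTrivial; prime[2])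
import Data.Nat.Tactic.RingSolver as ℕSolver
open import Data.Product as Product using (Σ; ∃; _,_; proj₁; proj₂)
open import Data.Sum using (_⊎_; inj₁; inj₂)
open import Function.Bundles using (mk⇔; Equivalence)
open import Relation.Nullary using (yes; no)
open import Relation.Binary.PropositionalEquality

open ℤS using (divides)

*-distribˡ-- : ∀ c x y → c * (x - y) ≡ c * x - c * y
*-distribˡ-- = solve-∀

prime≢1 : ∀ {q} → Prime q → q ≢ 1
prime≢1 q-prime refl with ℕ.nonTrivial⇒n>1 1 {{prime⇒nonTrivial q-prime}}
... | ℕ.s≤s ()

prime∤prime : ∀ {p q} → Prime p → Prime q → q ≢ p → ¬ (q ∣ p)
prime∤prime p-prime q-prime q≢p q∣p with prime⇒irreducible p-prime q∣p
... | inj₁ q≡1 = prime≢1 q-prime q≡1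
... | inj₂ q≡p = q≢p q≡p

module QAdic (q : ℕ) where

  -- A record rather than a synonym, so that the exponent l is recoverable by unification.
  infix 4 q^_∣_
  record q^_∣_ (l : ℕ) (z : ℤ) : Set where
    constructor mk∣
    field divisibility : + (q ℕ.^ l) ℤS.∣ z

  fromℤ∣ : ∀ {l z} → + (q ℕ.^ l) ℤ∣.∣ z → q^ l ∣ z
  fromℤ∣ d = mk∣ (ℤS.∣ᵤ⇒∣ d)

  toℤ∣ : ∀ {l z} → q^ l ∣ z → + (q ℕ.^ l) ℤ∣.∣ z
  toℤ∣ (mk∣ d) = ℤS.∣⇒∣ᵤ d

  q^suc : ∀ l → + (q ℕ.^ suc l) ≡ + q * + (q ℕ.^ l)
  q^suc l = ℤP.pos-* q (q ℕ.^ l)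

  q^∣-resp : ∀ {l x y} → x ≡ y → q^ l ∣ x → q^ l ∣ y
  q^∣-resp refl d = d

  q^∣0 : ∀ {l} → q^ l ∣ + 0
  q^∣0 = mk∣ (divides (+ 0) refl)

  q^∣-+ : ∀ {l x y} → q^ l ∣ x → q^ l ∣ y → q^ l ∣ (x + y)
  q^∣-+ (mk∣ d) (mk∣ e) = mk∣ (ℤS.∣m∣n⇒∣m+n d e)

  q^∣-- : ∀ {l x y} → q^ l ∣ x → q^ l ∣ y → q^ l ∣ (x - y)
  q^∣-- (mk∣ d) (mk∣ e) = mk∣ (ℤS.∣m∣n⇒∣m-n d e)

  q^∣-* : ∀ {l x} c → q^ l ∣ x → q^ l ∣ (c * x)
  q^∣-* c (mk∣ d) = mk∣ (ℤS.∣n⇒∣m*n c d)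

  q^∣-*ʳ : ∀ {l x} c → q^ l ∣ x → q^ l ∣ (x * c)
  q^∣-*ʳ {x = x} c d = q^∣-resp (ℤP.*-comm c x) (q^∣-* c d)

  q^∣-neg : ∀ {l x} → q^ l ∣ x → q^ l ∣ (- x)
  q^∣-neg (mk∣ d) = mk∣ (ℤS.∣m⇒∣-m d)

  q^suc∣⇒q^∣ : ∀ {l z} → q^ suc l ∣ z → q^ l ∣ z
  q^suc∣⇒q^∣ {l} (mk∣ (divides t z≡tq)) = mk∣ (divides (t * + q)
    (trans z≡tq (trans (cong (t *_) (q^suc l)) (sym (ℤP.*-assoc t (+ q) _)))))

  q^1∣ : ∀ {z} t → z ≡ t * + q → q^ 1 ∣ z
  q^1∣ t z≡tq = mk∣ (divides t (trans z≡tq (cong (λ c → t * + c) (sym (ℕP.*-identityʳ q)))))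

  q^∣-square : ∀ {l e} → q^ suc l ∣ e → q^ suc (suc l) ∣ (- (e * e))
  q^∣-square {l} {e} (mk∣ (divides t e≡tQq)) = mk∣ (divides (- (t * t * Q)) (begin
      - (e * e)                             ≡⟨ cong (λ z → - (z * z)) (trans e≡tQq (cong (t *_) (q^suc l))) ⟩
      - ((t * (+ q * Q)) * (t * (+ q * Q))) ≡⟨ square (+ q) t Q ⟩
      - (t * t * Q) * (+ q * (+ q * Q))     ≡⟨ cong (λ z → - (t * t * Q) * z) (sym (trans (q^suc (suc l)) (cong (+ q *_) (q^suc l)))) ⟩
      - (t * t * Q) * + (q ℕ.^ suc (suc l)) ∎))
    where
    open ≡-Reasoning
    Q = + (q ℕ.^ l)
    square : ∀ q t Q → - ((t * (q * Q)) * (t * (q * Q))) ≡ - (t * t * Q) * (q * (q * Q))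
    square = solve-∀

  q^∣-*-cong : ∀ {l x x' y y'} → q^ l ∣ (x - x') → q^ l ∣ (y - y') → q^ l ∣ (x * y - x' * y')
  q^∣-*-cong {x = x} {x'} {y} {y'} dx dy =
    q^∣-resp (sym (split x x' y y')) (q^∣-+ (q^∣-*ʳ y dx) (q^∣-* x' dy))
    where
    split : ∀ x x' y y' → x * y - x' * y' ≡ (x - x') * y + x' * (y - y')
    split = solve-∀

  sum-q^∣ : ∀ {n l} (f : Fin n → ℤ) → (∀ i → q^ l ∣ f i) → q^ l ∣ sumℤ f
  sum-q^∣ {zero}  f d = q^∣0
  sum-q^∣ {suc n} f d = q^∣-+ (d F.zero) (sum-q^∣ (λ i → f (F.suc i)) (λ i → d (F.suc i)))

  scale : ℤ → ℤ[ q ] → ℤ[ q ]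
  scale c x = record
    { seq    = λ l → c * seq x l
    ; compat = λ l → toℤ∣ (q^∣-resp (*-distribˡ-- c _ _) (q^∣-* c (fromℤ∣ {l} (compat x l)))) }

  translate : ℤ → ℤ[ q ] → ℤ[ q ]
  translate j x = record
    { seq    = λ l → seq x l + j
    ; compat = λ l → toℤ∣ (q^∣-resp (cancel j (seq x (suc l)) (seq x l)) (fromℤ∣ {l} (compat x l))) }
    where
    cancel : ∀ j x y → x - y ≡ x + j - (y + j)
    cancel = solve-∀

  record IsUnit (c : ℤ) : Set where
    field
      inverse₁         : ℤ
      inverse₁-correct : q^ 1 ∣ (c * inverse₁ - + 1)

  -- Newton's iteration u ↦ u (2 - c u) squares the error c u - 1, so an inverse
  -- modulo q lifts to a compatible sequence of inverses modulo every q^l.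
  module Inverse {c : ℤ} (c-unit : IsUnit c) where
    open IsUnit c-unit

    inverse : ℕ → ℤ
    inverse zero    = inverse₁
    inverse (suc l) = inverse l * (+ 2 - c * inverse l)

    inverse-correct : ∀ l → q^ suc l ∣ (c * inverse l - + 1)
    inverse-correct zero    = inverse₁-correct
    inverse-correct (suc l) = q^∣-resp (newton c (inverse l)) (q^∣-square (inverse-correct l))
      where
      newton : ∀ c u → - ((c * u - + 1) * (c * u - + 1)) ≡ c * (u * (+ 2 - c * u)) - + 1
      newton = solve-∀

    inverse-compat : ∀ l → q^ l ∣ (inverse (suc l) - inverse l)
    inverse-compat l = q^∣-resp (sym (step c (inverse l)))
      (q^∣-neg (q^∣-* (inverse l) (q^suc∣⇒q^∣ (inverse-correct l))))
      where
      step : ∀ c u → u * (+ 2 - c * u) - u ≡ - (u * (c * u - + 1))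
      step = solve-∀

    divide : ℤ[ q ] → ℤ[ q ]
    divide z = record
      { seq    = λ l → inverse l * seq z l
      ; compat = λ l → toℤ∣ (q^∣-resp (sym (split (inverse (suc l)) (inverse l) (seq z (suc l)) (seq z l)))
          (q^∣-+ (q^∣-* (inverse (suc l)) (fromℤ∣ {l} (compat z l))) (q^∣-*ʳ (seq z l) (inverse-compat l)))) }
      where
      split : ∀ u₁ u₀ z₁ z₀ → u₁ * z₁ - u₀ * z₀ ≡ u₁ * (z₁ - z₀) + (u₁ - u₀) * z₀
      split = solve-∀

    *-divide : ∀ z l → q^ l ∣ (c * seq (divide z) l - seq z l)
    *-divide z l = q^∣-resp (sym (factor c (inverse l) (seq z l)))
      (q^∣-*ʳ (seq z l) (q^suc∣⇒q^∣ (inverse-correct l)))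
      where
      factor : ∀ c u z → c * (u * z) - z ≡ (c * u - + 1) * z
      factor = solve-∀

    cancel : ∀ {l z} → q^ l ∣ (c * z) → q^ l ∣ z
    cancel {l} {z} d = q^∣-resp (sym (recover c (inverse l) z))
      (q^∣-- (q^∣-* (inverse l) d) (q^∣-*ʳ z (q^suc∣⇒q^∣ (inverse-correct l))))
      where
      recover : ∀ c u z → z ≡ u * (c * z) - (c * u - + 1) * z
      recover = solve-∀

  isUnit-1 : IsUnit (+ 1)
  isUnit-1 = record { inverse₁ = + 1 ; inverse₁-correct = q^∣0 }

  isUnit-* : ∀ {c d} → IsUnit c → IsUnit d → IsUnit (c * d)
  isUnit-* {c} {d} c-unit d-unit = record
    { inverse₁         = u * v
    ; inverse₁-correct = q^∣-resp (sym (split c d u v))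
        (q^∣-+ (q^∣-*ʳ (d * v) (inverse₁-correct c-unit)) (inverse₁-correct d-unit)) }
    where
    open IsUnit
    u = inverse₁ c-unit
    v = inverse₁ d-unit
    split : ∀ c d u v → c * d * (u * v) - + 1 ≡ (c * u - + 1) * (d * v) + (d * v - + 1)
    split = solve-∀

  isUnit-^ : ∀ {p} → IsUnit (+ p) → ∀ k → IsUnit (+ (p ℕ.^ k))
  isUnit-^ p-unit zero        = isUnit-1
  isUnit-^ {p} p-unit (suc k) = subst IsUnit (sym (ℤP.pos-* p (p ℕ.^ k))) (isUnit-* p-unit (isUnit-^ p-unit k))

  bézout⇒isUnit : ∀ {c} → Bézout.Identity 1 q c → IsUnit (+ c)
  bézout⇒isUnit {c} (Bézout.+- x y 1+yc≡xq) = record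
    { inverse₁         = - + y
    ; inverse₁-correct = q^1∣ (- + x) (trans (rearrange (+ y) (+ c)) (trans (cong -_ lifted) (ℤP.neg-distribˡ-* (+ x) (+ q)))) }
    where
    lifted : + 1 + + y * + c ≡ + x * + q
    lifted = trans (cong (_+_ (+ 1)) (sym (ℤP.pos-* y c))) (trans (cong +_ 1+yc≡xq) (ℤP.pos-* x q))
    rearrange : ∀ y c → c * (- y) - + 1 ≡ - (+ 1 + y * c)
    rearrange = solve-∀
  bézout⇒isUnit {c} (Bézout.-+ x y 1+xq≡yc) = record
    { inverse₁         = + y
    ; inverse₁-correct = q^1∣ (+ x) (trans (cong (_- + 1) (trans (ℤP.*-comm (+ c) (+ y)) (sym lifted))) (rearrange (+ x) (+ q))) }
    where
    lifted : + 1 + + x * + q ≡ + y * + c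
    lifted = trans (cong (_+_ (+ 1)) (sym (ℤP.pos-* x q))) (trans (cong +_ 1+xq≡yc) (ℤP.pos-* y c))
    rearrange : ∀ x q → + 1 + x * q - + 1 ≡ x * q
    rearrange = solve-∀

  prime∤⇒isUnit : Prime q → ∀ c → ¬ (q ∣ c) → IsUnit (+ c)
  prime∤⇒isUnit q-prime c q∤c = bézout⇒isUnit (Coprimality.coprime-Bézout coprime)
    where
    coprime : Coprimality.Coprime q c
    coprime (d∣q , d∣c) with prime⇒irreducible q-prime d∣q
    ... | inj₁ d≡1 = d≡1
    ... | inj₂ refl = ⊥-elim (q∤c d∣c)

  halve : Prime q → ∀ {l d} → q^ suc l ∣ (+ 2 * d) → q^ l ∣ d
  halve q-prime {l} {d} (mk∣ q^[1+l]∣2d) with q ℕ.≟ 2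
  ... | yes refl = mk∣ (ℤS.*-cancelˡ-∣ (+ 2) (subst (ℤS._∣ + 2 * d) (q^suc l) q^[1+l]∣2d))
  ... | no q≢2   = Inverse.cancel two-unit (q^suc∣⇒q^∣ (mk∣ q^[1+l]∣2d))
    where
    two-unit : IsUnit (+ 2)
    two-unit = prime∤⇒isUnit q-prime 2 (prime∤prime prime[2] q-prime q≢2)

2∤1 : ¬ (+ 2 ℤS.∣ + 1)
2∤1 2∣1 with ℕ∣.∣1⇒≡1 (ℤS.∣⇒∣ᵤ 2∣1)
... | ()

2*[z/2]≡z : ∀ z t → z ≡ + 2 * t → + 2 * (z /ℕ 2) ≡ z
2*[z/2]≡z z t z≡2t with z %ℕ 2 | n%ℕd<d z 2 | a≡a%ℕn+[a/ℕn]*n z 2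
... | 0 | _ | z≡0+Q2 = sym (trans z≡0+Q2 (rearrange (z /ℕ 2)))
  where
  rearrange : ∀ Q → + 0 + Q * + 2 ≡ + 2 * Q
  rearrange = solve-∀
... | 1 | _ | z≡1+Q2 = ⊥-elim (2∤1 (divides (t - Q) (begin
    + 1                 ≡⟨ add-sub Q ⟩
    + 1 + Q * + 2 - Q * + 2 ≡⟨ cong (_- Q * + 2) (trans (sym z≡1+Q2) z≡2t) ⟩
    + 2 * t - Q * + 2   ≡⟨ factor t Q ⟩
    (t - Q) * + 2       ∎)))
  where
  open ≡-Reasoning
  Q = z /ℕ 2
  add-sub : ∀ Q → + 1 ≡ + 1 + Q * + 2 - Q * + 2
  add-sub = solve-∀
  factor : ∀ t Q → + 2 * t - Q * + 2 ≡ (t - Q) * + 2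
  factor = solve-∀
... | suc (suc _) | ℕ.s≤s (ℕ.s≤s ()) | _

x*x-x-even : ∀ x → ∃ λ t → x * x - x ≡ + 2 * t
x*x-x-even x with x %ℕ 2 | n%ℕd<d x 2 | a≡a%ℕn+[a/ℕn]*n x 2
... | 0 | _ | x≡0+Q2 = _ , trans (cong (λ y → y * y - y) x≡0+Q2) (even (x /ℕ 2))
  where
  even : ∀ Q → (+ 0 + Q * + 2) * (+ 0 + Q * + 2) - (+ 0 + Q * + 2) ≡ + 2 * (+ 2 * Q * Q - Q)
  even = solve-∀
... | 1 | _ | x≡1+Q2 = _ , trans (cong (λ y → y * y - y) x≡1+Q2) (odd (x /ℕ 2))
  where
  odd : ∀ Q → (+ 1 + Q * + 2) * (+ 1 + Q * + 2) - (+ 1 + Q * + 2) ≡ + 2 * (Q * (+ 1 + Q * + 2))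
  odd = solve-∀
... | suc (suc _) | ℕ.s≤s (ℕ.s≤s ()) | _

numerator : ℕ → ℤ → ℤ → ℤ
numerator m r x = + (m ℕ.∸ 2) * x * x - (+ (m ℕ.∸ 2) - + 2 * r) * x

2*P≡numerator : ∀ m r x → + 2 * P m r x ≡ numerator m r x
2*P≡numerator m r x = 2*[z/2]≡z (numerator m r x) (A * t + r * x) (begin
  numerator m r x           ≡⟨ split A r x ⟩
  A * (x * x - x) + + 2 * r * x ≡⟨ cong (λ y → A * y + + 2 * r * x) (proj₂ (x*x-x-even x)) ⟩
  A * (+ 2 * t) + + 2 * r * x   ≡⟨ collect A r t x ⟩
  + 2 * (A * t + r * x)     ∎)
  where
  open ≡-Reasoning
  A = + (m ℕ.∸ 2)
  t = proj₁ (x*x-x-even x)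
  split : ∀ A r x → A * x * x - (A - + 2 * r) * x ≡ A * (x * x - x) + + 2 * r * x
  split = solve-∀
  collect : ∀ A r t x → A * (+ 2 * t) + + 2 * r * x ≡ + 2 * (A * t + r * x)
  collect = solve-∀

numerator-shift : ∀ m (p r r' j x : ℤ) →
  + 2 * p * r' ≡ + (m ℕ.∸ 2) * (p + + 2 * j) - (+ (m ℕ.∸ 2) - + 2 * r) →
  p * p * numerator m r' x ≡ numerator m r (p * x + j) - numerator m r j
numerator-shift m p r r' j x 2pr'≡ = begin
  p * p * numerator m r' x                                  ≡⟨ isolate A p x r' ⟩
  p * p * (A * x * x - A * x) + p * x * (+ 2 * p * r')      ≡⟨ cong (λ y → p * p * (A * x * x - A * x) + p * x * y) 2pr'≡ ⟩
  p * p * (A * x * x - A * x) + p * x * (A * (p + + 2 * j) - (A - + 2 * r)) ≡⟨ expand A p x j r ⟩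
  numerator m r (p * x + j) - numerator m r j               ∎
  where
  open ≡-Reasoning
  A = + (m ℕ.∸ 2)
  isolate : ∀ A p x r' → p * p * (A * x * x - (A - + 2 * r') * x) ≡ p * p * (A * x * x - A * x) + p * x * (+ 2 * p * r')
  isolate = solve-∀
  expand : ∀ A p x j r → p * p * (A * x * x - A * x) + p * x * (A * (p + + 2 * j) - (A - + 2 * r))
                       ≡ (A * (p * x + j) * (p * x + j) - (A - + 2 * r) * (p * x + j)) - (A * j * j - (A - + 2 * r) * j)
  expand = solve-∀

P-shift : ∀ m (p r r' j x : ℤ) →
  + 2 * p * r' ≡ + (m ℕ.∸ 2) * (p + + 2 * j) - (+ (m ℕ.∸ 2) - + 2 * r) →
  p * p * P m r' x ≡ P m r (p * x + j) - P m r j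
P-shift m p r r' j x 2pr'≡ = ℤP.*-cancelˡ-≡ (+ 2) (p * p * P m r' x) (P m r (p * x + j) - P m r j) (begin
  + 2 * (p * p * P m r' x)                         ≡⟨ reassoc p (P m r' x) ⟩
  p * p * (+ 2 * P m r' x)                         ≡⟨ cong (p * p *_) (2*P≡numerator m r' x) ⟩
  p * p * numerator m r' x                         ≡⟨ numerator-shift m p r r' j x 2pr'≡ ⟩
  numerator m r (p * x + j) - numerator m r j      ≡⟨ sym (cong₂ _-_ (2*P≡numerator m r (p * x + j)) (2*P≡numerator m r j)) ⟩
  + 2 * P m r (p * x + j) - + 2 * P m r j          ≡⟨ sym (*-distribˡ-- (+ 2) (P m r (p * x + j)) (P m r j)) ⟩
  + 2 * (P m r (p * x + j) - P m r j)              ∎)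
  where
  open ≡-Reasoning
  reassoc : ∀ p y → + 2 * (p * p * y) ≡ p * p * (+ 2 * y)
  reassoc = solve-∀

2*P-difference : ∀ m r y y' → + 2 * (P m r y - P m r y') ≡ (y - y') * (+ (m ℕ.∸ 2) * (y + y') - (+ (m ℕ.∸ 2) - + 2 * r))
2*P-difference m r y y' = begin
  + 2 * (P m r y - P m r y')                ≡⟨ *-distribˡ-- (+ 2) (P m r y) (P m r y') ⟩
  + 2 * P m r y - + 2 * P m r y'            ≡⟨ cong₂ _-_ (2*P≡numerator m r y) (2*P≡numerator m r y') ⟩
  numerator m r y - numerator m r y'        ≡⟨ factor (+ (m ℕ.∸ 2)) r y y' ⟩
  (y - y') * (+ (m ℕ.∸ 2) * (y + y') - (+ (m ℕ.∸ 2) - + 2 * r)) ∎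
  where
  open ≡-Reasoning
  factor : ∀ A r y y' → (A * y * y - (A - + 2 * r) * y) - (A * y' * y' - (A - + 2 * r) * y')
                      ≡ (y - y') * (A * (y + y') - (A - + 2 * r))
  factor = solve-∀

sumℤ-cong : ∀ {n} {f g : Fin n → ℤ} → (∀ i → f i ≡ g i) → sumℤ f ≡ sumℤ g
sumℤ-cong {zero}  f≗g = refl
sumℤ-cong {suc n} f≗g = cong₂ _+_ (f≗g F.zero) (sumℤ-cong (λ i → f≗g (F.suc i)))

sumℤ-*ˡ : ∀ {n} c (f : Fin n → ℤ) → sumℤ (λ i → c * f i) ≡ c * sumℤ f
sumℤ-*ˡ {zero}  c f = sym (ℤP.*-zeroʳ c)
sumℤ-*ˡ {suc n} c f = trans (cong (_+_ (c * f F.zero)) (sumℤ-*ˡ c (λ i → f (F.suc i))))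
                            (sym (ℤP.*-distribˡ-+ c (f F.zero) _))

sumℤ-- : ∀ {n} (f g : Fin n → ℤ) → sumℤ (λ i → f i - g i) ≡ sumℤ f - sumℤ g
sumℤ-- {zero}  f g = refl
sumℤ-- {suc n} f g = trans (cong (_+_ (f F.zero - g F.zero)) (sumℤ-- (λ i → f (F.suc i)) (λ i → g (F.suc i))))
                           (interchange (f F.zero) (g F.zero) _ _)
  where
  interchange : ∀ a b c d → (a - b) + (c - d) ≡ (a + c) - (b + d)
  interchange = solve-∀

module _ {q : ℕ} (q-prime : Prime q) (m : ℕ) where
  open QAdic q

  P-cong : ∀ {l} r y y' → q^ suc l ∣ (y - y') → q^ l ∣ (P m r y - P m r y')
  P-cong r y y' y≡y' = halve q-prime (q^∣-resp (sym (2*P-difference m r y y')) (q^∣-*ʳ _ y≡y'))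

  formVal-cong : ∀ {n l} (a r y y' : Fin n → ℤ) → (∀ i → q^ suc l ∣ (y i - y' i)) →
                 q^ l ∣ (formVal m a r y - formVal m a r y')
  formVal-cong a r y y' y≡y' = q^∣-resp (sumℤ-- (term y) (term y'))
    (sum-q^∣ (λ i → term y i - term y' i) (λ i → q^∣-resp (*-distribˡ-- (a i) (P m (r i) (y i)) (P m (r i) (y' i)))
      (q^∣-* (a i) (P-cong (r i) (y i) (y' i) (y≡y' i)))))
    where
    term : (Fin _ → ℤ) → Fin _ → ℤ
    term z i = a i * P m (r i) (z i)

record AffinelyRelated (q m : ℕ) (K a r b r' : ℤ) : Set where
  field
    τ j c    : ℤ
    τ-unit   : QAdic.IsUnit q τ
    relation : ∀ x → K * (b * P m r' x) ≡ a * P m r (τ * x + j) - c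

module ZUniversal-transfer {q m n : ℕ} (q-prime : Prime q) {K : ℤ} (K-unit : QAdic.IsUnit q K)
  {a r b r' : Fin n → ℤ} (related : ∀ i → AffinelyRelated q m K (a i) (r i) (b i) (r' i)) where
  open QAdic q
  open module Rel i = AffinelyRelated (related i)

  C : ℤ
  C = sumℤ c

  formVal-relation : ∀ x → K * formVal m b r' x ≡ formVal m a r (λ i → τ i * x i + j i) - C
  formVal-relation x = trans (sym (sumℤ-*ˡ K (λ i → b i * P m (r' i) (x i))))
    (trans (sumℤ-cong (λ i → relation i (x i))) (sumℤ-- (λ i → a i * P m (r i) (τ i * x i + j i)) c))

  universal-⇐ : ZUniversal q m b r' → ZUniversal q m a r
  universal-⇐ b-universal N = y , λ l → toℤ∣ (y-solves l)
    where
    N' = Inverse.divide K-unit (translate (- C) N)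
    x = proj₁ (b-universal N')
    y = λ i → translate (j i) (scale (τ i) (x i))
    y-solves : ∀ l → q^ l ∣ (formVal m a r (λ i → seq (y i) (suc l)) - seq N l)
    y-solves l = q^∣-resp (sym (rearrange (formVal-relation (λ i → seq (x i) (suc l)))))
      (q^∣-+ (q^∣-* K (fromℤ∣ {l} (proj₂ (b-universal N') l))) (Inverse.*-divide K-unit (translate (- C) N) l))
      where
      G = formVal m a r (λ i → seq (y i) (suc l))
      F = formVal m b r' (λ i → seq (x i) (suc l))
      rearrange : K * F ≡ G - C → G - seq N l ≡ K * (F - seq N' l) + (K * seq N' l - (seq N l + - C))
      rearrange KF≡G-C = trans (split G (seq N l) C)
        (trans (cong (_+ (C - seq N l)) (sym KF≡G-C)) (regroup K F (seq N' l) (seq N l) C))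
        where
        split : ∀ G N C → G - N ≡ (G - C) + (C - N)
        split = solve-∀
        regroup : ∀ K F N' N C → K * F + (C - N) ≡ K * (F - N') + (K * N' - (N + - C))
        regroup = solve-∀

  universal-⇒ : ZUniversal q m a r → ZUniversal q m b r'
  universal-⇒ a-universal N' = x , λ l → toℤ∣ (x-solves l)
    where
    Z = translate C (scale K N')
    y = proj₁ (a-universal Z)
    x = λ i → Inverse.divide (τ-unit i) (translate (- j i) (y i))
    x-solves : ∀ l → q^ l ∣ (formVal m b r' (λ i → seq (x i) (suc l)) - seq N' l)
    x-solves l = Inverse.cancel K-unit (q^∣-resp (sym (rearrange (formVal-relation (λ i → seq (x i) (suc l)))))
      (q^∣-+ (formVal-cong q-prime m a r _ _ τx+j≡y) (fromℤ∣ {l} (proj₂ (a-universal Z) l))))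
      where
      G' = formVal m a r (λ i → τ i * seq (x i) (suc l) + j i)
      G  = formVal m a r (λ i → seq (y i) (suc l))
      F  = formVal m b r' (λ i → seq (x i) (suc l))
      τx+j≡y : ∀ i → q^ suc l ∣ ((τ i * seq (x i) (suc l) + j i) - seq (y i) (suc l))
      τx+j≡y i = q^∣-resp (shift (τ i) _ _ (j i)) (Inverse.*-divide (τ-unit i) (translate (- j i) (y i)) (suc l))
        where
        shift : ∀ τ w y j → τ * w - (y + - j) ≡ τ * w + j - y
        shift = solve-∀
      rearrange : K * F ≡ G' - C → K * (F - seq N' l) ≡ (G' - G) + (G - (K * seq N' l + C))
      rearrange KF≡G'-C = trans (*-distribˡ-- K F (seq N' l))
        (trans (cong (_- K * seq N' l) KF≡G'-C) (regroup G' G C K (seq N' l)))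
        where
        regroup : ∀ G' G C K N' → G' - C - K * N' ≡ (G' - G) + (G - (K * N' + C))
        regroup = solve-∀

  universal⇔ : ZUniversal q m a r ⇔ ZUniversal q m b r'
  universal⇔ = mk⇔ universal-⇒ universal-⇐

LambdaCoordinate : (m p k a r b : ℕ) → ℤ → Set
LambdaCoordinate m p k a r b r' =
    ((p ∣ a) → ((p ℕ.^ k) ℕ.* b ≡ a) × (r' ≡ + r))
  × ((¬ (p ∣ a)) → ((p ℕ.^ k) ℕ.* b ≡ p ℕ.* p ℕ.* a)
       × Σ ℤ λ j → JCond m p r j
           × (+ (2 ℕ.* p) ℤ.* r' ≡ (+ (m ℕ.∸ 2)) ℤ.* (+ p ℤ.+ + 2 ℤ.* j) - ((+ (m ℕ.∸ 2)) - + 2 ℤ.* + r)))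

lambda-affinelyRelated : ∀ {q m p k a r b r'} → QAdic.IsUnit q (+ p) → LambdaCoordinate m p k a r b r' →
                         AffinelyRelated q m (+ (p ℕ.^ k)) (+ a) (+ r) (+ b) r'
lambda-affinelyRelated {q} {m} {p} {k} {a} {r} {b} {r'} p-unit (when-p∣a , when-p∤a) with p ℕ∣.∣? a
... | yes p∣a = record { τ = + 1 ; j = + 0 ; c = + 0 ; τ-unit = QAdic.isUnit-1 q ; relation = relation }
  where
  p^kb≡a = proj₁ (when-p∣a p∣a)
  r'≡r   = proj₂ (when-p∣a p∣a)
  relation : ∀ x → + (p ℕ.^ k) * (+ b * P m r' x) ≡ + a * P m (+ r) (+ 1 * x + + 0) - + 0
  relation x = begin
    + (p ℕ.^ k) * (+ b * P m r' x)     ≡⟨ sym (ℤP.*-assoc (+ (p ℕ.^ k)) (+ b) _) ⟩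
    + (p ℕ.^ k) * + b * P m r' x       ≡⟨ cong (_* P m r' x) (trans (sym (ℤP.pos-* (p ℕ.^ k) b)) (cong +_ p^kb≡a)) ⟩
    + a * P m r' x                     ≡⟨ cong (λ s → + a * P m s x) r'≡r ⟩
    + a * P m (+ r) x                  ≡⟨ cong (λ y → + a * P m (+ r) y) (sym (trans (ℤP.+-identityʳ (+ 1 * x)) (ℤP.*-identityˡ x))) ⟩
    + a * P m (+ r) (+ 1 * x + + 0)    ≡⟨ sym (ℤP.+-identityʳ _) ⟩
    + a * P m (+ r) (+ 1 * x + + 0) - + 0 ∎
    where open ≡-Reasoning
... | no p∤a = record { τ = + p ; j = j ; c = + a * P m (+ r) j ; τ-unit = p-unit ; relation = relation }
  where
  p^kb≡ppa = proj₁ (when-p∤a p∤a)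
  j        = proj₁ (proj₂ (when-p∤a p∤a))
  2pr'≡    = proj₂ (proj₂ (proj₂ (when-p∤a p∤a)))
  relation : ∀ x → + (p ℕ.^ k) * (+ b * P m r' x) ≡ + a * P m (+ r) (+ p * x + j) - + a * P m (+ r) j
  relation x = begin
    + (p ℕ.^ k) * (+ b * P m r' x)        ≡⟨ sym (ℤP.*-assoc (+ (p ℕ.^ k)) (+ b) _) ⟩
    + (p ℕ.^ k) * + b * P m r' x          ≡⟨ cong (_* P m r' x) (trans (sym (ℤP.pos-* (p ℕ.^ k) b)) (trans (cong +_ p^kb≡ppa) ppa)) ⟩
    + p * + p * + a * P m r' x            ≡⟨ reassoc (+ p) (+ a) (P m r' x) ⟩
    + a * (+ p * + p * P m r' x)          ≡⟨ cong (+ a *_) (P-shift m (+ p) (+ r) r' j x (trans (cong (_* r') (sym (ℤP.pos-* 2 p))) 2pr'≡)) ⟩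
    + a * (P m (+ r) (+ p * x + j) - P m (+ r) j) ≡⟨ *-distribˡ-- (+ a) _ _ ⟩
    + a * P m (+ r) (+ p * x + j) - + a * P m (+ r) j ∎
    where
    open ≡-Reasoning
    ppa : + (p ℕ.* p ℕ.* a) ≡ + p * + p * + a
    ppa = trans (ℤP.pos-* (p ℕ.* p) a) (cong (_* + a) (ℤP.pos-* p p))
    reassoc : ∀ p a y → p * p * a * y ≡ a * (p * p * y)
    reassoc = solve-∀

Odd : ℤ → Set
Odd z = ∃ λ h → z ≡ + 1 + + 2 * h

odd-* : ∀ {x y} → Odd x → Odd y → Odd (x * y)
odd-* (h , x≡) (h' , y≡) = h + h' + + 2 * h * h' , trans (cong₂ _*_ x≡ y≡) (expand h h')
  where
  expand : ∀ h h' → (+ 1 + + 2 * h) * (+ 1 + + 2 * h') ≡ + 1 + + 2 * (h + h' + + 2 * h * h')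
  expand = solve-∀

2∤⇒odd : ∀ p → ¬ (2 ∣ p) → Odd (+ p)
2∤⇒odd p 2∤p with p ℕ/.% 2 | ℕ/.m%n<n p 2 | ℕ/.m≡m%n+[m/n]*n p 2
... | 0 | _ | p≡0+Q2 = ⊥-elim (2∤p (ℕ∣.divides (p ℕ/./ 2) p≡0+Q2))
... | 1 | _ | p≡1+Q2 = + (p ℕ/./ 2) , trans (cong +_ p≡1+Q2)
      (trans (ℤP.pos-+ 1 _) (cong (_+_ (+ 1)) (trans (ℤP.pos-* (p ℕ/./ 2) 2) (ℤP.*-comm (+ (p ℕ/./ 2)) (+ 2)))))
... | suc (suc _) | ℕ.s≤s (ℕ.s≤s ()) | _

odd-^ : ∀ {p} → Odd (+ p) → ∀ e → Odd (+ (p ℕ.^ e))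
odd-^ p-odd zero        = + 0 , refl
odd-^ {p} p-odd (suc e) = subst Odd (sym (ℤP.pos-* p (p ℕ.^ e))) (odd-* p-odd (odd-^ p-odd e))

open QAdic 2

odd⇒isUnit : ∀ {s} → Odd s → IsUnit s
odd⇒isUnit {s} (h , s≡) = record
  { inverse₁ = s ; inverse₁-correct = q^1∣ (+ 2 * h * h + + 2 * h) (trans (cong (λ z → z * z - + 1) s≡) (square h)) }
  where
  square : ∀ h → (+ 1 + + 2 * h) * (+ 1 + + 2 * h) - + 1 ≡ (+ 2 * h * h + + 2 * h) * + 2
  square = solve-∀

odd-mod-4 : ∀ {c} → Odd c → q^ 2 ∣ (c - + 1) ⊎ q^ 2 ∣ (c - + 3)
odd-mod-4 {c} (h , c≡) with h %ℕ 2 | n%ℕd<d h 2 | a≡a%ℕn+[a/ℕn]*n h 2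
... | 0 | _ | h≡0+Q2 = inj₁ (mk∣ (divides (h /ℕ 2)
      (trans (cong (_- + 1) (trans c≡ (cong (λ z → + 1 + + 2 * z) h≡0+Q2))) (mod4 (h /ℕ 2)))))
  where
  mod4 : ∀ Q → + 1 + + 2 * (+ 0 + Q * + 2) - + 1 ≡ Q * + 4
  mod4 = solve-∀
... | 1 | _ | h≡1+Q2 = inj₂ (mk∣ (divides (h /ℕ 2)
      (trans (cong (_- + 3) (trans c≡ (cong (λ z → + 1 + + 2 * z) h≡1+Q2))) (mod4 (h /ℕ 2)))))
  where
  mod4 : ∀ Q → + 1 + + 2 * (+ 1 + Q * + 2) - + 3 ≡ Q * + 4
  mod4 = solve-∀
... | suc (suc _) | ℕ.s≤s (ℕ.s≤s ()) | _

module _ {n} {a b s : Fin n → ℤ} {c : ℤ} (rescaled : ∀ i → a i * s i * s i ≡ c * b i) (s-odd : ∀ i → Odd (s i)) where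

  bilinear-rescaled : ∀ (x y : Fin n → ℤ) →
    sumℤ (λ i → a i * (s i * x i) * (s i * y i)) ≡ c * sumℤ (λ i → b i * x i * y i)
  bilinear-rescaled x y = trans (sumℤ-cong term) (sumℤ-*ˡ c (λ i → b i * x i * y i))
    where
    term : ∀ i → a i * (s i * x i) * (s i * y i) ≡ c * (b i * x i * y i)
    term i = begin
      a i * (s i * x i) * (s i * y i)   ≡⟨ regroup (a i) (s i) (x i) (y i) ⟩
      a i * s i * s i * (x i * y i)     ≡⟨ cong (_* (x i * y i)) (rescaled i) ⟩
      c * b i * (x i * y i)             ≡⟨ reassoc c (b i) (x i) (y i) ⟩
      c * (b i * x i * y i)             ∎
      where
      open ≡-Reasoning
      regroup : ∀ a s x y → a * (s * x) * (s * y) ≡ a * s * s * (x * y)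
      regroup = solve-∀
      reassoc : ∀ c b x y → c * b * (x * y) ≡ c * (b * x * y)
      reassoc = solve-∀

  Represents₂-rescale : ∀ {u u'} → Represents₂ b u u' → Represents₂ a (scale c u) (scale c u')
  Represents₂-rescale {u} {u'} (v , w , Qv≡u , Qw≡u' , Bvw≡0 , independent) =
    V , W , Q-rescaled v u Qv≡u , Q-rescaled w u' Qw≡u' , B-rescaled , Independent
    where
    V W : Fin n → ℤ[ 2 ]
    V i = scale (s i) (v i)
    W i = scale (s i) (w i)
    Q-rescaled : ∀ v u → (∀ k → + (2 ℕ.^ k) ℤ∣.∣ (sumℤ (λ i → b i * seq (v i) k * seq (v i) k) - seq u k)) →
      ∀ k → + (2 ℕ.^ k) ℤ∣.∣ (sumℤ (λ i → a i * (s i * seq (v i) k) * (s i * seq (v i) k)) - c * seq u k)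
    Q-rescaled v u Qv≡u k = toℤ∣ (q^∣-resp (trans (*-distribˡ-- c _ _) (cong (_- c * seq u k) (sym (bilinear-rescaled _ _))))
      (q^∣-* c (fromℤ∣ {k} (Qv≡u k))))
    B-rescaled : ∀ k → + (2 ℕ.^ k) ℤ∣.∣ sumℤ (λ i → a i * seq (V i) k * seq (W i) k)
    B-rescaled k = toℤ∣ (q^∣-resp (sym (bilinear-rescaled _ _)) (q^∣-* c (fromℤ∣ {k} (Bvw≡0 k))))
    Independent : ∀ α β → (∀ i k → + (2 ℕ.^ k) ℤ∣.∣ (seq α k * seq (V i) k + seq β k * seq (W i) k)) →
                  (∀ k → + (2 ℕ.^ k) ℤ∣.∣ seq α k) × (∀ k → + (2 ℕ.^ k) ℤ∣.∣ seq β k)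
    Independent α β αV+βW≡0 = independent α β λ i k → toℤ∣ (Inverse.cancel (odd⇒isUnit (s-odd i))
      (q^∣-resp (factor (seq α k) (seq β k) (s i) _ _) (fromℤ∣ {k} (αV+βW≡0 i k))))
      where
      factor : ∀ α β s x y → α * (s * x) + β * (s * y) ≡ s * (α * x + β * y)
      factor = solve-∀

Represents₂-swap : ∀ {n} {b : Fin n → ℤ} {u u'} → Represents₂ b u u' → Represents₂ b u' u
Represents₂-swap {b = b} (v , w , Qv≡u , Qw≡u' , Bvw≡0 , independent) =
  w , v , Qw≡u' , Qv≡u , (λ k → toℤ∣ (q^∣-resp (sumℤ-cong (λ i → swap (b i) _ _)) (fromℤ∣ {k} (Bvw≡0 k)))) ,
  λ α β αw+βv≡0 → Product.swap (independent β α λ i k →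
    toℤ∣ (q^∣-resp (ℤP.+-comm (seq α k * seq (w i) k) (seq β k * seq (v i) k)) (fromℤ∣ {k} (αw+βv≡0 i k))))
  where
  swap : ∀ b x y → b * x * y ≡ b * y * x
  swap = solve-∀

*-cong-mod-4 : ∀ c e {f} (x : ℤ[ 2 ]) → q^ 2 ∣ (c - e) → + 4 ℤ∣.∣ (seq x 2 - f) → + 4 ℤ∣.∣ (c * seq x 2 - e * f)
*-cong-mod-4 c e {f} x c≡e x≡f = toℤ∣ (q^∣-*-cong {x = c} {e} {seq x 2} {f} c≡e (fromℤ∣ {2} {seq x 2 - f} x≡f))

-- Scaling by c maps ⟨u, u'⟩ to ⟨cu, cu'⟩; for c ≡ 3 (mod 4) the residues 1 and 3 trade places.
RepsMixedBinary-rescale : ∀ {n} {a b s : Fin n → ℤ} {c : ℤ} → (∀ i → a i * s i * s i ≡ c * b i) →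
  Odd c → (∀ i → Odd (s i)) → RepsMixedBinary b → RepsMixedBinary a
RepsMixedBinary-rescale {a = a} {b} {s} {c} rescaled c-odd s-odd (u , u' , u≡1 , u'≡3 , reps) with odd-mod-4 c-odd
... | inj₁ c≡1 = scale c u , scale c u' , *-cong-mod-4 c (+ 1) u c≡1 u≡1 , *-cong-mod-4 c (+ 1) u' c≡1 u'≡3 ,
      Represents₂-rescale {a = a} {b} {s} {c} rescaled s-odd {u} {u'} reps
... | inj₂ c≡3 = scale c u' , scale c u ,
      toℤ∣ (q^∣-resp (nine≡one (c * seq u' 2))
        (q^∣-+ (fromℤ∣ {2} {c * seq u' 2 - + 9} (*-cong-mod-4 c (+ 3) u' c≡3 u'≡3)) (mk∣ (divides (+ 2) refl)))) ,
      *-cong-mod-4 c (+ 3) u c≡3 u≡1 ,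
      Represents₂-swap {b = a} {scale c u} {scale c u'}
        (Represents₂-rescale {a = a} {b} {s} {c} rescaled s-odd {u} {u'} reps)
  where
  nine≡one : ∀ z → z - + 9 + + 8 ≡ z - + 1
  nine≡one = solve-∀

pos-rescaled : ∀ a s c b → a ℕ.* s ℕ.* s ≡ c ℕ.* b → + a * + s * + s ≡ + c * + b
pos-rescaled a s c b eq = trans (cong (_* + s) (sym (ℤP.pos-* a s)))
  (trans (sym (ℤP.pos-* (a ℕ.* s) s)) (trans (cong +_ eq) (ℤP.pos-* c b)))

p^[2∸k]*p^k≡p*p : ∀ p {k} → k ℕ.≤ 2 → p ℕ.^ (2 ℕ.∸ k) ℕ.* p ℕ.^ k ≡ p ℕ.* p
p^[2∸k]*p^k≡p*p p {k} k≤2 = begin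
  p ℕ.^ (2 ℕ.∸ k) ℕ.* p ℕ.^ k ≡⟨ ℕP.^-distribˡ-+-* p (2 ℕ.∸ k) k ⟨
  p ℕ.^ (2 ℕ.∸ k ℕ.+ k)       ≡⟨ cong (p ℕ.^_) (ℕP.m∸n+n≡m k≤2) ⟩
  p ℕ.* (p ℕ.* 1)             ≡⟨ cong (p ℕ.*_) (ℕP.*-identityʳ p) ⟩
  p ℕ.* p                     ∎
  where open ≡-Reasoning

module _ {m p k : ℕ} (2∤p : ¬ (2 ∣ p)) where

  private
    p-odd : Odd (+ p)
    p-odd = 2∤⇒odd p 2∤p
    p^k≢0 : NonZero (p ℕ.^ k)
    p^k≢0 = ℕP.m^n≢0 p k {{ℕ.≢-nonZero λ { refl → 2∤p (2 ℕ∣.∣0) }}}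

  lambda-rescales-a : ∀ {a r b r'} → LambdaCoordinate m p k a r b r' →
                      Σ ℤ λ s → Odd s × (+ a * s * s ≡ + (p ℕ.^ k) * + b)
  lambda-rescales-a {a} {r} {b} (when-p∣a , when-p∤a) with p ℕ∣.∣? a
  ... | yes p∣a = + 1 , (+ 0 , refl) , pos-rescaled a 1 (p ℕ.^ k) b
      (trans (ℕP.*-identityʳ (a ℕ.* 1)) (trans (ℕP.*-identityʳ a) (sym (proj₁ (when-p∣a p∣a)))))
  ... | no p∤a  = + p , p-odd , pos-rescaled a p (p ℕ.^ k) b (trans (swap a p) (sym (proj₁ (when-p∤a p∤a))))
    where
    swap : ∀ a p → a ℕ.* p ℕ.* p ≡ p ℕ.* p ℕ.* a
    swap = ℕSolver.solve-∀

  lambda-rescales-b : ∀ {a r b r'} → k ℕ.≤ 2 → LambdaCoordinate m p k a r b r' →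
                      Σ ℤ λ s → Odd s × (+ b * s * s ≡ + (p ℕ.^ (2 ℕ.∸ k)) * + a)
  lambda-rescales-b {a} {r} {b} k≤2 (when-p∣a , when-p∤a) with p ℕ∣.∣? a
  ... | yes p∣a = + p , p-odd , pos-rescaled b p (p ℕ.^ (2 ℕ.∸ k)) a (begin
    b ℕ.* p ℕ.* p                    ≡⟨ swap b p ⟩
    p ℕ.* p ℕ.* b                    ≡⟨ cong (ℕ._* b) (sym (p^[2∸k]*p^k≡p*p p k≤2)) ⟩
    p ℕ.^ (2 ℕ.∸ k) ℕ.* p ℕ.^ k ℕ.* b  ≡⟨ ℕP.*-assoc (p ℕ.^ (2 ℕ.∸ k)) _ b ⟩
    p ℕ.^ (2 ℕ.∸ k) ℕ.* (p ℕ.^ k ℕ.* b) ≡⟨ cong (p ℕ.^ (2 ℕ.∸ k) ℕ.*_) (proj₁ (when-p∣a p∣a)) ⟩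
    p ℕ.^ (2 ℕ.∸ k) ℕ.* a            ∎)
    where
    open ≡-Reasoning
    swap : ∀ b p → b ℕ.* p ℕ.* p ≡ p ℕ.* p ℕ.* b
    swap = ℕSolver.solve-∀
  ... | no p∤a = + 1 , (+ 0 , refl) , pos-rescaled b 1 (p ℕ.^ (2 ℕ.∸ k)) a
      (ℕP.*-cancelˡ-≡ _ _ (p ℕ.^ k) {{p^k≢0}} (begin
    p ℕ.^ k ℕ.* (b ℕ.* 1 ℕ.* 1)       ≡⟨ cong (p ℕ.^ k ℕ.*_) (trans (ℕP.*-identityʳ (b ℕ.* 1)) (ℕP.*-identityʳ b)) ⟩
    p ℕ.^ k ℕ.* b                     ≡⟨ proj₁ (when-p∤a p∤a) ⟩
    p ℕ.* p ℕ.* a                     ≡⟨ cong (ℕ._* a) (sym (p^[2∸k]*p^k≡p*p p k≤2)) ⟩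
    p ℕ.^ (2 ℕ.∸ k) ℕ.* p ℕ.^ k ℕ.* a   ≡⟨ swap (p ℕ.^ (2 ℕ.∸ k)) (p ℕ.^ k) a ⟩
    p ℕ.^ k ℕ.* (p ℕ.^ (2 ℕ.∸ k) ℕ.* a) ∎))
    where
    open ≡-Reasoning
    swap : ∀ x y a → x ℕ.* y ℕ.* a ≡ y ℕ.* (x ℕ.* a)
    swap = ℕSolver.solve-∀

module LambdaTransformation (m p : ℕ) {n} (a r b : Fin n → ℕ) (r' : Fin n → ℤ) (is-λ : IsLambda m p a r b r') where
  private
    k = proj₁ is-λ
    k≤2 = proj₁ (proj₁ (proj₂ is-λ))
    coordinates = proj₂ (proj₂ is-λ)

  ZUniversal⇔ : Prime p → ∀ {q} → Prime q → q ≢ p →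
                ZUniversal q m (λ i → + a i) (λ i → + r i) ⇔ ZUniversal q m (λ i → + b i) r'
  ZUniversal⇔ p-prime {q} q-prime q≢p =
    ZUniversal-transfer.universal⇔ {q} {m} {n} q-prime (QAdic.isUnit-^ q p-unit k)
      {λ i → + a i} {λ i → + r i} {λ i → + b i} {r'} (λ i → lambda-affinelyRelated {q} {m} {p} {k} p-unit (coordinates i))
    where
    p-unit = QAdic.prime∤⇒isUnit q q-prime p (prime∤prime p-prime q-prime q≢p)

  RepsMixedBinary⇔ : ¬ (2 ∣ p) → RepsMixedBinary (λ i → + a i) ⇔ RepsMixedBinary (λ i → + b i)
  RepsMixedBinary⇔ 2∤p = mk⇔
    (RepsMixedBinary-rescale {a = λ i → + b i} {λ i → + a i} {λ i → proj₁ (b-rescaling i)} {+ (p ℕ.^ (2 ℕ.∸ k))}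
       (λ i → proj₂ (proj₂ (b-rescaling i))) (odd-^ p-odd (2 ℕ.∸ k)) (λ i → proj₁ (proj₂ (b-rescaling i))))
    (RepsMixedBinary-rescale {a = λ i → + a i} {λ i → + b i} {λ i → proj₁ (a-rescaling i)} {+ (p ℕ.^ k)}
       (λ i → proj₂ (proj₂ (a-rescaling i))) (odd-^ p-odd k) (λ i → proj₁ (proj₂ (a-rescaling i))))
    where
    p-odd = 2∤⇒odd p 2∤p
    a-rescaling = λ i → lambda-rescales-a {m} {p} {k} 2∤p {a i} {r i} {b i} {r' i} (coordinates i)
    b-rescaling = λ i → lambda-rescales-b {m} {p} {k} 2∤p {a i} {r i} {b i} {r' i} k≤2 (coordinates i)

lemma3p2 : (m n : ℕ) (a r : Fin n → ℕ) (p : ℕ) →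
    IsPrimShiftedForm m a r → Prime p → LambdaAdmissible m p →
    (b : Fin n → ℕ) (r' : Fin n → ℤ) → IsLambda m p a r b r' →
      ((q : ℕ) → Prime q → q ≢ p →
         ZUniversal q m (λ i → + a i) (λ i → + r i) ⇔ ZUniversal q m (λ i → + b i) r')
    × (¬ (2 ∣ p) → ¬ ZUniversal 2 m (λ i → + a i) (λ i → + r i) →
         (RepsMixedBinary (λ i → + a i) →
            ¬ ZUniversal 2 m (λ i → + b i) r' × RepsMixedBinary (λ i → + b i))
       × (¬ RepsMixedBinary (λ i → + a i) →
            ¬ ZUniversal 2 m (λ i → + b i) r' × ¬ RepsMixedBinary (λ i → + b i)))
lemma3p2 m n a r p _ p-prime _ b r' is-λ =
  (λ q → ZUniversal⇔ p-prime {q}) ,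
  λ 2∤p ¬a-universal →
    let ¬b-universal = λ b-universal →
          ¬a-universal (Equivalence.from (ZUniversal⇔ p-prime prime[2] (2≢p 2∤p)) b-universal)
    in (λ a-reps → ¬b-universal , Equivalence.to (RepsMixedBinary⇔ 2∤p) a-reps) ,
       (λ ¬a-reps → ¬b-universal , λ b-reps → ¬a-reps (Equivalence.from (RepsMixedBinary⇔ 2∤p) b-reps))
  where
  open LambdaTransformation m p a r b r' is-λ
  2≢p : ¬ (2 ∣ p) → 2 ≢ p
  2≢p 2∤p refl = 2∤p ℕ∣.∣-refl
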